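{- Let $G$ be a graph with $P(G)=2$ whose vertex set is covered by two vertex-disjoint induced paths $P_1$ and $P_2$ with $|V(P_1)|=m$ and $|V(P_2)|=n$. Then $2\le Z(G)\le \min\{m,n\}+1$. Moreover, for any positive integers $m,n$ and any integer $k$ with $2\le k\le \min\{m,n\}+1$, there is a graph $G$ with $P(G)=2$, whose vertex set is covered by two vertex-disjoint induced paths of orders $m$ and $n$, such that $Z(G)=k$.
   Context: All graphs are finite and simple. $P(G)$ is the minimum number of vertex-disjoint induced paths covering $V(G)$. Zero forcing: if a black vertex $u$ has exactly one white neighbour $v$, then $u$ may force $v$ black; a zero forcing set is an initial set of black vertices from which repeated forcing blackens all vertices; $Z(G)$ is the minimum size of a zero forcing set. -}

module Defs where

open import Data.Nat using (ℕ; zero; suc; _≤_)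
open import Data.Fin using (Fin; toℕ)
open import Data.Fin.Subset using (Subset; _∈_; ∣_∣)
open import Data.Vec using (Vec; lookup)
open import Data.Product using (Σ; ∃; ∃-syntax; _×_)
open import Data.Sum using (_⊎_)
open import Function.Definitions using (Injective)
open import Relation.Binary.PropositionalEquality using (_≡_)
open import Relation.Nullary using (¬_)
open import Level using (0ℓ)

record Graph (N : ℕ) : Set₁ where
  field
    Adj    : Fin N → Fin N → Set
    sym    : ∀ {u v} → Adj u v → Adj v u
    irrefl : ∀ {v} → ¬ Adj v v
open Graph public

record InducedPath {N : ℕ} (G : Graph N) : Set where
  field
    len      : ℕ
    nonempty : 1 ≤ len
    vert     : Fin len → Fin N
    inj      : Injective _≡_ _≡_ vert
    adj⇒cons : ∀ i j → Adj G (vert i) (vert j) →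
               (toℕ i ≡ suc (toℕ j)) ⊎ (toℕ j ≡ suc (toℕ i))
    cons⇒adj : ∀ i j → (toℕ i ≡ suc (toℕ j)) ⊎ (toℕ j ≡ suc (toℕ i)) →
               Adj G (vert i) (vert j)
open InducedPath public

IsPathCover : ∀ {N} (G : Graph N) {k : ℕ} → Vec (InducedPath G) k → Set
IsPathCover {N} G {k} ps =
  (∀ (v : Fin N) → ∃[ i ] ∃[ p ] vert (lookup ps i) p ≡ v) ×
  (∀ (i j : Fin k) p q → vert (lookup ps i) p ≡ vert (lookup ps j) q → i ≡ j)

PathCoverNumber : ∀ {N} (G : Graph N) → ℕ → Set
PathCoverNumber G k =
  (Σ (Vec (InducedPath G) k) (IsPathCover G)) ×
  (∀ (l : ℕ) (ps : Vec (InducedPath G) l) → IsPathCover G ps → k ≤ l)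

data Black {N : ℕ} (G : Graph N) (S : Subset N) : Fin N → Set where
  initial : ∀ {v} → v ∈ S → Black G S v
  force   : ∀ {u v} → Black G S u → Adj G u v →
            (∀ w → Adj G u w → ¬ (w ≡ v) → Black G S w) →
            Black G S v

IsZeroForcingSet : ∀ {N} (G : Graph N) → Subset N → Set
IsZeroForcingSet {N} G S = ∀ (v : Fin N) → Black G S v

ZeroForcingNumber : ∀ {N} (G : Graph N) → ℕ → Set
ZeroForcingNumber {N} G k =
  (∃[ S ] (∣ S ∣ ≡ k × IsZeroForcingSet G S)) ×
  (∀ (S : Subset N) → IsZeroForcingSet G S → k ≤ ∣ S ∣)

-- A zero forcing set with at most one vertex forces along a single chain, which
-- is then a spanning induced path (module OneVertexForcing), contradicting P(G) = 2.  The
-- vertices of one path plus the first vertex of the other force G, since an induced path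
-- is forced along itself from its first vertex once its outside neighbours are black
-- (forcePath).
--
-- All graphs are two paths on 0 … m-1 and m … m+n-1 plus cross edges
-- (module TwoPaths); for them P(G) = 2 follows from Z(G) ≥ 2.  For k = 2 take no cross
-- edges: a forcing set meets both components.  For k = c + 1 ≥ 3 join the first c
-- vertices of both paths completely.  Its lower bound retracts each path onto these core
-- vertices: forcing transfers to the graph of core edges (transfer), where the first
-- force is made by a vertex with c + 2 vertices in its closed neighbourhood
-- (firstForce-bound).
module Submission where

open import Defs hiding (sym)
open import Data.Nat as ℕ using (ℕ; zero; suc; _≤_; _<_; _+_; _∸_; _⊓_; z≤n; s≤s; _≤?_; _<?_)
open import Data.Nat.Properties hiding (_≟_)
open import Data.Fin as Fin using (Fin; zero; suc; toℕ; fromℕ<)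
import Data.Fin.Properties as Finₚ
open import Data.Fin.Properties using (any?; toℕ-injective)
open import Data.Fin.Subset as Sub using (Subset; _∈_; _∉_; ∣_∣; ⁅_⁆; _∪_; _-_; inside; outside)
open import Data.Fin.Subset.Properties
open import Data.Vec using (Vec; []; _∷_; lookup; tabulate)
open import Data.Vec.Properties using (lookup∘tabulate; []=⇒lookup; lookup⇒[]=)
open import Data.Bool using (true)
open import Data.Product using (Σ; ∃-syntax; _×_; _,_; proj₁; proj₂)
open import Data.Sum using (_⊎_; inj₁; inj₂; swap)
open import Data.Empty using (⊥; ⊥-elim)
open import Function using (_∘_; case_of_)
open import Function.Definitions using (Injective)
open import Relation.Binary.Definitions using (tri<; tri≈; tri>)
open import Relation.Nullary using (¬_; Dec; yes; no; ¬?; does)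
open import Relation.Nullary.Decidable using (_×-dec_; _⊎-dec_; decidable-stable; dec-true; ¬¬-excluded-middle)
open import Relation.Binary.PropositionalEquality
  using (_≡_; _≢_; refl; sym; trans; cong; subst; subst₂; module ≡-Reasoning)

Distinct : ∀ {N} → ℕ → (Fin N → Set) → Set
Distinct {N} k P = Σ (Fin k → Fin N) λ f → Injective _≡_ _≡_ f × (∀ i → P (f i))

distinct⇒≤∣∣ : ∀ {N} k (S : Subset N) → Distinct k (_∈ S) → k ≤ ∣ S ∣
distinct⇒≤∣∣ zero    S _             = z≤n
distinct⇒≤∣∣ (suc k) S (f , injective , mem) =
  ≤-trans (s≤s (distinct⇒≤∣∣ k (S - f zero) rest)) (x∈p⇒∣p-x∣<∣p∣ (mem zero))
  where
  rest : Distinct k (_∈ S - f zero)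
  rest = f ∘ suc , (λ e → Finₚ.suc-injective (injective e)) ,
         λ i → x∈p∧x≢y⇒x∈p-y (mem (suc i)) (λ e → Finₚ.0≢1+n (injective (sym e)))

distinct-map : ∀ {N k} {P Q : Fin N → Set} → (∀ {x} → P x → Q x) → Distinct k P → Distinct k Q
distinct-map P⇒Q (f , injective , p) = f , injective , λ i → P⇒Q (p i)

distinct-cons : ∀ {N k} {P Q : Fin N → Set} {x} → P x → Distinct k Q →
                (∀ {y} → Q y → y ≢ x × P y) → Distinct (suc k) P
distinct-cons {N} {k} {P} {Q} {x} px (f , injective , q) fresh = g , g-inj , g-mem
  where
  g : Fin (suc k) → Fin N
  g zero    = x
  g (suc i) = f i
  g-inj : Injective _≡_ _≡_ g
  g-inj {zero}  {zero}  _ = refl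
  g-inj {zero}  {suc j} e = ⊥-elim (proj₁ (fresh (q j)) (sym e))
  g-inj {suc i} {zero}  e = ⊥-elim (proj₁ (fresh (q i)) e)
  g-inj {suc i} {suc j} e = cong suc (injective e)
  g-mem : ∀ i → P (g i)
  g-mem zero    = px
  g-mem (suc i) = proj₂ (fresh (q i))

distinct-pair : ∀ {N} {P : Fin N → Set} {x y} → x ≢ y → P x → P y → Distinct 2 P
distinct-pair {P = P} {y = y} x≢y px py = distinct-cons {P = P} {Q = _≡ y} px single (λ { refl → (λ e → x≢y (sym e)) , py })
  where
  single : Distinct 1 (_≡ y)
  single = (λ _ → y) , (λ { {zero} {zero} _ → refl }) , λ _ → refl

distinct-drop : ∀ {N k} {P : Fin N → Set} (v : Fin N) → Distinct (suc k) P →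
                Distinct k (λ x → x ≢ v × P x)
distinct-drop v (h , injective , p) with any? (λ i → h i Fin.≟ v)
... | yes (i₀ , hi₀≡v) = h ∘ Fin.punchIn i₀ , (λ e → Finₚ.punchIn-injective i₀ _ _ (injective e)) ,
                         λ i → (λ e → Finₚ.punchInᵢ≢i i₀ i (injective (trans e (sym hi₀≡v)))) , p _
... | no  v∉h          = h ∘ suc , (λ e → Finₚ.suc-injective (injective e)) ,
                         λ i → (λ e → v∉h (suc i , e)) , p _

distinct-preimage : ∀ {N M k} (S : Subset N) (φ : Fin N → Fin M) →
                    Distinct k (λ y → ∃[ s ] (s ∈ S × φ s ≡ y)) → Distinct k (_∈ S)
distinct-preimage {N} {k = k} S φ (f , injective , pre) = pick , pick-inj , λ i → proj₁ (proj₂ (pre i))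
  where
  open ≡-Reasoning
  pick : Fin k → Fin N
  pick i = proj₁ (pre i)
  pick-inj : Injective _≡_ _≡_ pick
  pick-inj {i} {j} e = injective (begin
    f i         ≡⟨ sym (proj₂ (proj₂ (pre i))) ⟩
    φ (pick i)  ≡⟨ cong φ e ⟩
    φ (pick j)  ≡⟨ proj₂ (proj₂ (pre j)) ⟩
    f j         ∎)

∣∣<2⇒unique : ∀ {N} (S : Subset N) → ∣ S ∣ < 2 → ∀ {x y} → x ∈ S → y ∈ S → x ≡ y
∣∣<2⇒unique S small {x} {y} x∈S y∈S with x Fin.≟ y
... | yes x≡y = x≡y
... | no  x≢y = ⊥-elim (<⇒≱ small (distinct⇒≤∣∣ 2 S (distinct-pair x≢y x∈S y∈S)))

∣p∪q∣≤∣p∣+∣q∣ : ∀ {n} (p q : Subset n) → ∣ p ∪ q ∣ ≤ ∣ p ∣ + ∣ q ∣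
∣p∪q∣≤∣p∣+∣q∣ []            []            = z≤n
∣p∪q∣≤∣p∣+∣q∣ (inside ∷ p)  (y ∷ q)       = s≤s (≤-trans (∣p∪q∣≤∣p∣+∣q∣ p q) (+-monoʳ-≤ ∣ p ∣ (∣p∣≤∣x∷p∣ y q)))
∣p∪q∣≤∣p∣+∣q∣ (outside ∷ p) (inside ∷ q)  = ≤-trans (s≤s (∣p∪q∣≤∣p∣+∣q∣ p q)) (≤-reflexive (sym (+-suc ∣ p ∣ ∣ q ∣)))
∣p∪q∣≤∣p∣+∣q∣ (outside ∷ p) (outside ∷ q) = ∣p∪q∣≤∣p∣+∣q∣ p q

image : ∀ {N} k → (Fin k → Fin N) → Subset N
image zero    f = Sub.⊥
image (suc k) f = ⁅ f zero ⁆ ∪ image k (f ∘ suc)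

∣image∣≤ : ∀ {N} k (f : Fin k → Fin N) → ∣ image k f ∣ ≤ k
∣image∣≤ {N} zero    f = ≤-reflexive (∣⊥∣≡0 N)
∣image∣≤     (suc k) f = begin
  ∣ ⁅ f zero ⁆ ∪ image k (f ∘ suc) ∣       ≤⟨ ∣p∪q∣≤∣p∣+∣q∣ ⁅ f zero ⁆ _ ⟩
  ∣ ⁅ f zero ⁆ ∣ + ∣ image k (f ∘ suc) ∣   ≡⟨ cong (_+ ∣ image k (f ∘ suc) ∣) (∣⁅x⁆∣≡1 (f zero)) ⟩
  suc ∣ image k (f ∘ suc) ∣                ≤⟨ s≤s (∣image∣≤ k (f ∘ suc)) ⟩
  suc k                                    ∎
  where open ≤-Reasoning

∈image : ∀ {N} k (f : Fin k → Fin N) i → f i ∈ image k f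
∈image (suc k) f zero    = x∈p∪q⁺ (inj₁ (x∈⁅x⁆ (f zero)))
∈image (suc k) f (suc i) = x∈p∪q⁺ (inj₂ (∈image k (f ∘ suc) i))

toSubset : ∀ {N} {P : Fin N → Set} → (∀ y → Dec (P y)) → Subset N
toSubset P? = tabulate (λ y → does (P? y))

∈toSubset⁺ : ∀ {N} {P : Fin N → Set} (P? : ∀ y → Dec (P y)) {y} → P y → y ∈ toSubset P?
∈toSubset⁺ P? {y} py = lookup⇒[]= y _ (trans (lookup∘tabulate _ y) (dec-true (P? y) py))

∈toSubset⁻ : ∀ {N} {P : Fin N → Set} (P? : ∀ y → Dec (P y)) {y} → y ∈ toSubset P? → P y
∈toSubset⁻ P? {y} y∈ = witness (P? y) (trans (sym (lookup∘tabulate _ y)) ([]=⇒lookup y∈))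
  where
  witness : ∀ {A : Set} (a? : Dec A) → does a? ≡ true → A
  witness (yes a) _ = a

injective⇒onto : ∀ {n} (f : Fin n → Fin n) → Injective _≡_ _≡_ f → ∀ v → ∃[ p ] f p ≡ v
injective⇒onto {suc n} f injective v with any? (λ p → f p Fin.≟ v)
... | yes hit  = hit
... | no  miss = ⊥-elim (1+n≰n (Finₚ.injective⇒≤ squeeze-inj))
  where
  squeeze : Fin (suc n) → Fin n
  squeeze p = Fin.punchOut {i = v} {j = f p} (λ e → miss (p , sym e))
  squeeze-inj : Injective _≡_ _≡_ squeeze
  squeeze-inj {x} {y} e = injective (Finₚ.punchOut-injective {i = v} _ _ e)

-- Every relation on a finite set is decidable up to double negation; this is
-- enough whenever the goal is ⊥.
¬¬-∀Fin : ∀ n (P : Fin n → Set) → (∀ i → ¬ ¬ P i) → ¬ ¬ (∀ i → P i)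
¬¬-∀Fin zero    P h k = k λ ()
¬¬-∀Fin (suc n) P h k =
  h zero λ p₀ → ¬¬-∀Fin n (P ∘ suc) (h ∘ suc) λ ps → k λ { zero → p₀ ; (suc i) → ps i }

¬¬-decidable : ∀ {N} (R : Fin N → Fin N → Set) → ¬ ¬ (∀ u v → Dec (R u v))
¬¬-decidable {N} R =
  ¬¬-∀Fin N _ λ u → ¬¬-∀Fin N _ λ v → ¬¬-excluded-middle

Black-ind : ∀ {N} (G : Graph N) (S : Subset N) (T : Fin N → Set) →
  (∀ {v} → v ∈ S → T v) →
  (∀ {u v} → T u → Adj G u v → (∀ w → Adj G u w → w ≢ v → T w) → T v) →
  ∀ {v} → Black G S v → T v
Black-ind G S T init step (initial v∈S)      = init v∈S
Black-ind G S T init step (force bu a others) =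
  step (Black-ind G S T init step bu) a (λ w a′ w≢v → Black-ind G S T init step (others w a′ w≢v))

forced⇒meets : ∀ {N} (G : Graph N) (S : Subset N) (X : Fin N → Set) →
  (∀ {u v} → Adj G u v → X v → X u) → ∀ {v} → Black G S v → X v → ∃[ s ] (s ∈ S × X s)
forced⇒meets G S X closed =
  Black-ind G S (λ v → X v → ∃[ s ] (s ∈ S × X s)) (λ {v} v∈S xv → v , v∈S , xv)
            (λ meets a _ xv → meets (closed a xv))

OnPath : ∀ {N} {G : Graph N} → InducedPath G → Fin N → Set
OnPath Q v = ∃[ p ] vert Q p ≡ v

start : ∀ {N} {G : Graph N} → InducedPath G → Fin N
start Q = vert Q (fromℕ< (nonempty Q))

start-unique : ∀ {N} {G : Graph N} (Q : InducedPath G) i → toℕ i ≡ 0 → vert Q i ≡ start Q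
start-unique Q i i≡0 = cong (vert Q) (toℕ-injective (trans i≡0 (sym (Finₚ.toℕ-fromℕ< (nonempty Q)))))

-- Forcing along an induced path: if the start of Q is black and every neighbour of Q
-- off Q is black, then Q is forced vertex by vertex, each vertex forcing its successor
-- (an induced path gives the vertex q_i no other neighbours on Q than q_{i-1}, q_{i+1}).
forcePath : ∀ {N} (G : Graph N) (S : Subset N) (Q : InducedPath G) →
  Black G S (start Q) →
  (∀ i w → Adj G (vert Q i) w → ¬ OnPath Q w → Black G S w) →
  ∀ i → Black G S (vert Q i)
forcePath G S Q black₀ offQ i = upTo (toℕ i) i ≤-refl
  where
  predecessor : ∀ {L} (i : Fin L) {n} → toℕ i ≡ suc n → Σ (Fin L) λ i′ → toℕ i′ ≡ n
  predecessor (suc j) e = Fin.inject₁ j , trans (Finₚ.toℕ-inject₁ j) (suc-injective e)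

  upTo : ∀ n i → toℕ i ≤ n → Black G S (vert Q i)
  upTo zero i i≤0 = subst (Black G S) (sym (start-unique Q i (n≤0⇒n≡0 i≤0))) black₀
  upTo (suc n) i i≤1+n with m≤n⇒m<n∨m≡n i≤1+n
  ... | inj₁ i<1+n = upTo n i (≤-pred i<1+n)
  ... | inj₂ i≡1+n with predecessor i i≡1+n
  ... | i′ , i′≡n = force (upTo n i′ (≤-reflexive i′≡n)) (cons⇒adj Q i′ i (inj₂ next)) others
    where
    next : toℕ i ≡ suc (toℕ i′)
    next = trans i≡1+n (cong suc (sym i′≡n))
    others : ∀ w → Adj G (vert Q i′) w → w ≢ vert Q i → Black G S w
    others w a w≢qi with any? (λ p → vert Q p Fin.≟ w)
    ... | no  off       = offQ i′ w a (λ on → off on)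
    ... | yes (p , refl) with adj⇒cons Q i′ p a
    ...   | inj₁ i′≡1+p = upTo n p (≤-trans (n≤1+n _) (≤-reflexive (trans (sym i′≡1+p) i′≡n)))
    ...   | inj₂ p≡1+i′ = ⊥-elim (w≢qi (cong (vert Q) (toℕ-injective (trans p≡1+i′ (sym next)))))

forcing-from-path : ∀ {N} (G : Graph N) (S : Subset N) (Q : InducedPath G) →
  start Q ∈ S → (∀ v → ¬ OnPath Q v → Black G S v) → IsZeroForcingSet G S
forcing-from-path G S Q start∈S offQ v with any? (λ p → vert Q p Fin.≟ v)
... | yes (p , refl) = forcePath G S Q (initial start∈S) (λ _ w _ off → offQ w off) p
... | no  off        = offQ v off

-- If a vertex outside S gets forced, some force u → v happens first: u ∈ S and every
-- other neighbour of u is in S.  (Found by search, so adjacency must be decidable.)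
firstForce : ∀ {N} (G : Graph N) → (∀ u v → Dec (Adj G u v)) → (S : Subset N) →
  ∀ {x} → Black G S x → x ∉ S →
  ∃[ u ] ∃[ v ] (u ∈ S × Adj G u v × (∀ w → Adj G u w → w ≢ v → w ∈ S))
firstForce G adj? S (initial x∈S) x∉S = ⊥-elim (x∉S x∈S)
firstForce G adj? S {x} (force {u} bu a others) x∉S with u ∈? S
... | no  u∉S = firstForce G adj? S bu u∉S
... | yes u∈S with any? (λ w → adj? u w ×-dec (¬? (w Fin.≟ x) ×-dec ¬? (w ∈? S)))
...   | yes (w , a′ , w≢x , w∉S) = firstForce G adj? S (others w a′ w≢x) w∉S
...   | no  none = u , x , u∈S , a , λ w a′ w≢x →
          decidable-stable (w ∈? S) (λ w∉S → none (w , a′ , w≢x , w∉S))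

ClosedNbhd : ∀ {N} (G : Graph N) → Fin N → Fin N → Set
ClosedNbhd G u x = x ≡ u ⊎ Adj G u x

-- Degree bound (the argument behind Z(G) ≥ δ(G)): if a vertex outside S gets forced and
-- every non-isolated vertex has j + 1 vertices in its closed neighbourhood, then S has j
-- distinct members, because the first forcer u → v has N[u] ∖ {v} ⊆ S.
firstForce-bound : ∀ {N j} (G : Graph N) → (∀ u v → Dec (Adj G u v)) → (S : Subset N) →
  (∀ {u v} → Adj G u v → Distinct (suc j) (ClosedNbhd G u)) →
  ∀ {x} → Black G S x → x ∉ S → Distinct j (_∈ S)
firstForce-bound G adj? S nbhd bx x∉S with firstForce G adj? S bx x∉S
... | u , v , u∈S , a , rest = distinct-map (λ {w} → inS {w}) (distinct-drop {P = ClosedNbhd G u} v (nbhd a))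
  where
  inS : ∀ {w} → w ≢ v × ClosedNbhd G u w → w ∈ S
  inS (_   , inj₁ refl) = u∈S
  inS (w≢v , inj₂ a′)   = rest _ a′ w≢v

transfer : ∀ {N} (G G′ : Graph N) (φ : Fin N → Fin N) (S S′ : Subset N) →
  (∀ {v} → v ∈ S → φ v ∈ S′) →
  (∀ {u v} → Adj G u v → φ u ≢ φ v → φ u ≡ u × φ v ≡ v × Adj G′ u v) →
  (∀ {u w} → Adj G′ u w → Adj G u w × φ w ≡ w) →
  ∀ {v} → Black G S v → Black G′ S′ (φ v)
transfer G G′ φ S S′ image⊆ kept back = Black-ind G S (λ v → Black G′ S′ (φ v)) (λ v∈S → initial (image⊆ v∈S)) step
  where
  step : ∀ {u v} → Black G′ S′ (φ u) → Adj G u v →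
         (∀ w → Adj G u w → w ≢ v → Black G′ S′ (φ w)) → Black G′ S′ (φ v)
  step {u} {v} bu a others with φ u Fin.≟ φ v
  ... | yes φu≡φv = subst (Black G′ S′) φu≡φv bu
  ... | no  φu≢φv with kept a φu≢φv
  ... | φu≡u , φv≡v , a′ = subst (Black G′ S′) (sym φv≡v)
        (force (subst (Black G′ S′) φu≡u bu) a′
               (λ w uw w≢v → subst (Black G′ S′) (proj₂ (back uw)) (others w (proj₁ (back uw)) w≢v)))

-- If S ⊆ {s} forces G, the forces
-- form one chain s = f 0 → f 1 → ⋯ in which, when f j forces f (j+1), every other
-- neighbour of f j is one of f 0, …, f j; so the chain is an induced path through all
-- vertices.  It is built prefix by prefix: a prefix that cannot be extended would give
-- a proper set of vertices containing S and closed under forcing.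
module OneVertexForcing {N} (G : Graph N) (adj? : ∀ u v → Dec (Adj G u v))
                        (S : Subset N) (s : Fin N) (S⊆s : ∀ {v} → v ∈ S → v ≡ s)
                        (zf : IsZeroForcingSet G S) where

  Visited : (ℕ → Fin N) → ℕ → Fin N → Set
  Visited f i w = ∃[ k ] (k ≤ i × f k ≡ w)

  visited? : ∀ f i w → Dec (Visited f i w)
  visited? f i w with any? (λ (k : Fin (suc i)) → f (toℕ k) Fin.≟ w)
  ... | yes (k , e) = yes (toℕ k , ≤-pred (Finₚ.toℕ<n k) , e)
  ... | no  none    = no λ { (k , k≤i , e) →
          none (fromℕ< (s≤s k≤i) , trans (cong f (Finₚ.toℕ-fromℕ< (s≤s k≤i))) e) }

  record Chain (i : ℕ) : Set where
    field
      f        : ℕ → Fin N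
      f0≡s     : f 0 ≡ s
      distinct : ∀ j k → j ≤ i → k ≤ i → f j ≡ f k → j ≡ k
      step     : ∀ j → j < i → Adj G (f j) (f (suc j))
      earlier  : ∀ j → j < i → ∀ w → Adj G (f j) w → Visited f (suc j) w

  module _ {i} (C : Chain i) (short : suc i < N) where
    open Chain C

    -- The last vertex f i must force some vertex: otherwise the visited vertices contain
    -- S and are closed under forcing, so they would be all N > i + 1 vertices.
    mustForce : ¬ (∀ v → Adj G (f i) v → (∀ w → Adj G (f i) w → w ≢ v → Visited f i w) →
                   Visited f i v)
    mustForce lastStuck = <⇒≱ short (Finₚ.injective⇒≤ index-inj)
      where
      closed : ∀ {u v} → Visited f i u → Adj G u v →
               (∀ w → Adj G u w → w ≢ v → Visited f i w) → Visited f i v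
      closed (k , k≤i , refl) a others with m≤n⇒m<n∨m≡n k≤i
      ... | inj₁ k<i = let (k′ , k′≤1+k , e) = earlier k k<i _ a in k′ , ≤-trans k′≤1+k k<i , e
      ... | inj₂ refl = lastStuck _ a others
      visited : ∀ w → Visited f i w
      visited w = Black-ind G S (Visited f i) (λ v∈S → 0 , z≤n , trans f0≡s (sym (S⊆s v∈S)))
                            closed (zf w)
      index : Fin N → Fin (suc i)
      index w = fromℕ< (s≤s (proj₁ (proj₂ (visited w))))
      index-inj : Injective _≡_ _≡_ index
      index-inj {x} {y} e = begin
        x                                ≡⟨ sym (proj₂ (proj₂ (visited x))) ⟩
        f (proj₁ (visited x))            ≡⟨ cong f (Finₚ.fromℕ<-injective _ _ _ _ e) ⟩
        f (proj₁ (visited y))            ≡⟨ proj₂ (proj₂ (visited y)) ⟩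
        y                                ∎
        where open ≡-Reasoning

    fresh : ∃[ y ] (Adj G (f i) y × ¬ Visited f i y)
    fresh with any? (λ y → adj? (f i) y ×-dec ¬? (visited? f i y))
    ... | yes found = found
    ... | no  none  = ⊥-elim (mustForce λ v a _ →
            decidable-stable (visited? f i v) (λ unvisited → none (v , a , unvisited)))

    fresh-unique : ∀ {y w} → Adj G (f i) y → ¬ Visited f i y →
                   Adj G (f i) w → ¬ Visited f i w → w ≡ y
    fresh-unique {y} {w} ay y∉ aw w∉ with w Fin.≟ y
    ... | yes w≡y = w≡y
    ... | no  w≢y = ⊥-elim (mustForce λ v _ others → case v Fin.≟ y of λ
            { (yes refl) → ⊥-elim (w∉ (others w aw w≢y))
            ; (no v≢y)   → ⊥-elim (y∉ (others y ay λ y≡v → v≢y (sym y≡v))) })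

    extend : Chain (suc i)
    extend = record { f = f′ ; f0≡s = trans (old z≤n) f0≡s ; distinct = distinct′
                    ; step = step′ ; earlier = earlier′ }
      where
      y : Fin N
      y = proj₁ fresh
      ay : Adj G (f i) y
      ay = proj₁ (proj₂ fresh)
      y∉ : ¬ Visited f i y
      y∉ = proj₂ (proj₂ fresh)

      f′ : ℕ → Fin N
      f′ k with k ℕ.≟ suc i
      ... | yes _ = y
      ... | no  _ = f k

      old : ∀ {k} → k ≤ i → f′ k ≡ f k
      old {k} k≤i with k ℕ.≟ suc i
      ... | yes refl = ⊥-elim (1+n≰n k≤i)
      ... | no  _    = refl

      new : f′ (suc i) ≡ y
      new with suc i ℕ.≟ suc i
      ... | yes _ = refl
      ... | no  ≢ = ⊥-elim (≢ refl)

      distinct′ : ∀ j k → j ≤ suc i → k ≤ suc i → f′ j ≡ f′ k → j ≡ k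
      distinct′ j k j≤ k≤ e with m≤n⇒m<n∨m≡n j≤ | m≤n⇒m<n∨m≡n k≤
      ... | inj₁ j< | inj₁ k< = distinct j k (≤-pred j<) (≤-pred k<)
                                  (trans (sym (old (≤-pred j<))) (trans e (old (≤-pred k<))))
      ... | inj₂ refl | inj₂ refl = refl
      ... | inj₁ j< | inj₂ refl = ⊥-elim (y∉ (j , ≤-pred j< , trans (sym (old (≤-pred j<))) (trans e new)))
      ... | inj₂ refl | inj₁ k< = ⊥-elim (y∉ (k , ≤-pred k< , trans (sym (old (≤-pred k<))) (trans (sym e) new)))

      step′ : ∀ j → j < suc i → Adj G (f′ j) (f′ (suc j))
      step′ j j< with m≤n⇒m<n∨m≡n (≤-pred j<)
      ... | inj₁ j<i  = subst₂ (Adj G) (sym (old (<⇒≤ j<i))) (sym (old j<i)) (step j j<i)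
      ... | inj₂ refl = subst₂ (Adj G) (sym (old ≤-refl)) (sym new) ay

      earlier′ : ∀ j → j < suc i → ∀ w → Adj G (f′ j) w → Visited f′ (suc j) w
      earlier′ j j< w a with m≤n⇒m<n∨m≡n (≤-pred j<)
      ... | inj₁ j<i with earlier j j<i w (subst (λ z → Adj G z w) (old (<⇒≤ j<i)) a)
      ...   | k , k≤ , e = k , k≤ , trans (old (≤-trans k≤ j<i)) e
      earlier′ j j< w a | inj₂ refl with visited? f i w
      ...   | yes (k , k≤i , e) = k , m≤n⇒m≤1+n k≤i , trans (old k≤i) e
      ...   | no  w∉ = suc i , ≤-refl ,
                trans new (sym (fresh-unique ay y∉ (subst (λ z → Adj G z w) (old ≤-refl) a) w∉))

  chain : ∀ i → i < N → Chain i
  chain zero    _    = record { f = λ _ → s ; f0≡s = refl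
                              ; distinct = λ j k j≤0 k≤0 _ → trans (n≤0⇒n≡0 j≤0) (sym (n≤0⇒n≡0 k≤0))
                              ; step = λ _ () ; earlier = λ _ () }
  chain (suc i) i< = extend (chain i (<-trans (n<1+n i) i<)) i<

  spanningPath : ∀ {N′} → N ≡ suc N′ → Σ (InducedPath G) λ Q → ∀ v → OnPath Q v
  spanningPath {N′} refl = Q , injective⇒onto (vert Q) (inj Q)
    where
    open Chain (chain N′ (n<1+n N′))
    bound : ∀ (p : Fin (suc N′)) → toℕ p ≤ N′
    bound p = ≤-pred (Finₚ.toℕ<n p)
    successor-adj : ∀ (i j : Fin (suc N′)) → toℕ j ≡ suc (toℕ i) → Adj G (f (toℕ i)) (f (toℕ j))
    successor-adj i j e = subst (λ z → Adj G (f (toℕ i)) (f z)) (sym e)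
                            (step (toℕ i) (subst (_≤ N′) e (bound j)))
    forward : ∀ (i j : Fin (suc N′)) → toℕ i < toℕ j → Adj G (f (toℕ i)) (f (toℕ j)) →
              toℕ j ≡ suc (toℕ i)
    forward i j i<j a with earlier (toℕ i) (<-≤-trans i<j (bound j)) (f (toℕ j)) a
    ... | k , k≤ , e with distinct k (toℕ j) (≤-trans k≤ (<-≤-trans i<j (bound j))) (bound j) e
    ... | refl = ≤-antisym k≤ i<j
    adj⇒next : ∀ (i j : Fin (suc N′)) → Adj G (f (toℕ i)) (f (toℕ j)) →
               (toℕ i ≡ suc (toℕ j)) ⊎ (toℕ j ≡ suc (toℕ i))
    adj⇒next i j a with <-cmp (toℕ i) (toℕ j)
    ... | tri< i<j _ _ = inj₂ (forward i j i<j a)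
    ... | tri≈ _ i≡j _ = ⊥-elim (irrefl G (subst (λ z → Adj G (f (toℕ i)) (f z)) (sym i≡j) a))
    ... | tri> _ _ j<i = inj₁ (forward j i j<i (Graph.sym G a))
    Q : InducedPath G
    Q = record
      { len      = suc N′
      ; nonempty = s≤s z≤n
      ; vert     = λ p → f (toℕ p)
      ; inj      = λ {x} {y} e → toℕ-injective (distinct (toℕ x) (toℕ y) (bound x) (bound y) e)
      ; adj⇒cons = adj⇒next
      ; cons⇒adj = λ { i j (inj₁ e) → Graph.sym G (successor-adj j i e) ; i j (inj₂ e) → successor-adj i j e }
      }

singlePathCover : ∀ {N} (G : Graph N) (Q : InducedPath G) → (∀ v → OnPath Q v) →
                  IsPathCover G (Q ∷ [])
singlePathCover G Q covers = (λ v → zero , covers v) , λ { zero zero _ _ _ → refl }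

twoPathCover : ∀ {N} (G : Graph N) (A B : InducedPath G) → IsPathCover G (A ∷ B ∷ []) →
               ∀ v → OnPath A v ⊎ OnPath B v
twoPathCover G A B (covers , _) v with covers v
... | zero     , onA = inj₁ onA
... | suc zero , onB = inj₂ onB

-- Lower bound: if P(G) = 2 then Z(G) ≥ 2, since a zero forcing set with at most one
-- vertex would trace a spanning induced path.
Z≥2 : ∀ {N} (G : Graph N) → PathCoverNumber G 2 → ∀ S → IsZeroForcingSet G S → 2 ≤ ∣ S ∣
Z≥2 {N} G ((P₁ ∷ _ ∷ [] , _) , minimal) S zf with 2 ≤? ∣ S ∣
... | yes large = large
... | no  small = ⊥-elim (¬¬-decidable (Adj G) noSpanningPath)
  where
  centre : ∃[ s ] (∀ {v} → v ∈ S → v ≡ s)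
  centre with any? (_∈? S)
  ... | yes (s , s∈S) = s , λ v∈S → ∣∣<2⇒unique S (≰⇒> small) v∈S s∈S
  ... | no  empty     = start P₁ , λ {v} v∈S → ⊥-elim (empty (v , v∈S))
  positive : ∀ {M} → Fin M → ∃[ M′ ] M ≡ suc M′
  positive {suc M′} _ = M′ , refl
  noSpanningPath : ¬ (∀ u v → Dec (Adj G u v))
  noSpanningPath adj?
    with OneVertexForcing.spanningPath G adj? S (proj₁ centre) (proj₂ centre) zf
                                       (proj₂ (positive (start P₁)))
  ... | Q , covers = 1+n≰n (minimal 1 (Q ∷ []) (singlePathCover G Q covers))

-- Upper bound: if induced paths A and B cover G, then V(A) together with the start of B
-- is a zero forcing set (B is forced along itself), so Z(G) ≤ |V(A)| + 1.
Z≤ : ∀ {N} (G : Graph N) (A B : InducedPath G) → (∀ v → OnPath A v ⊎ OnPath B v) →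
     ∃[ S ] (IsZeroForcingSet G S × ∣ S ∣ ≤ len A + 1)
Z≤ {N} G A B covers = S , zf , subst (∣ S ∣ ≤_) (+-comm 1 (len A)) (∣image∣≤ (suc (len A)) g)
  where
  g : Fin (suc (len A)) → Fin N
  g zero    = start B
  g (suc p) = vert A p
  S : Subset N
  S = image (suc (len A)) g
  offB : ∀ v → ¬ OnPath B v → Black G S v
  offB v off with covers v
  ... | inj₁ (p , refl) = initial (∈image _ g (suc p))
  ... | inj₂ onB        = ⊥-elim (off onB)
  zf : IsZeroForcingSet G S
  zf = forcing-from-path G S B (∈image _ g zero) offB

zeroForcing-bounds : (N : ℕ) (G : Graph N) (P₁ P₂ : InducedPath G) →
  PathCoverNumber G 2 → IsPathCover G (P₁ ∷ P₂ ∷ []) →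
  ∀ (z : ℕ) → ZeroForcingNumber G z → 2 ≤ z × z ≤ (len P₁ ⊓ len P₂) + 1
zeroForcing-bounds N G P₁ P₂ P=2 cover z ((S , ∣S∣≡z , zf) , minimal) =
  subst (2 ≤_) ∣S∣≡z (Z≥2 G P=2 S zf) ,
  subst (z ≤_) (sym (+-distribʳ-⊓ 1 (len P₁) (len P₂)))
        (⊓-glb (viaPath P₁ P₂ covers) (viaPath P₂ P₁ (swap ∘ covers)))
  where
  covers : ∀ v → OnPath P₁ v ⊎ OnPath P₂ v
  covers = twoPathCover G P₁ P₂ cover
  viaPath : ∀ A B → (∀ v → OnPath A v ⊎ OnPath B v) → z ≤ len A + 1
  viaPath A B c with Z≤ G A B c
  ... | S′ , zf′ , ∣S′∣≤ = ≤-trans (minimal S′ zf′) ∣S′∣≤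

-- A cover by two induced paths gives P(G) = 2 as soon as Z(G) ≥ 2: an induced path
-- covering G on its own would be forced from its first vertex.
pathCoverNumber-two : ∀ {N} (G : Graph N) (P₁ P₂ : InducedPath G) → IsPathCover G (P₁ ∷ P₂ ∷ []) →
  (∀ S → IsZeroForcingSet G S → 2 ≤ ∣ S ∣) → PathCoverNumber G 2
pathCoverNumber-two {N} G P₁ P₂ cover Z≥2 = (P₁ ∷ P₂ ∷ [] , cover) , atLeastTwo
  where
  atLeastTwo : ∀ l (ps : Vec (InducedPath G) l) → IsPathCover G ps → 2 ≤ l
  atLeastTwo zero [] (covers , _) with covers (start P₁)
  ... | () , _
  atLeastTwo (suc zero) (Q ∷ []) (covers , _) =
    ⊥-elim (1+n≰n (≤-trans (Z≥2 ⁅ start Q ⁆ zf) (≤-reflexive (∣⁅x⁆∣≡1 (start Q)))))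
    where
    offQ : ∀ v → ¬ OnPath Q v → Black G ⁅ start Q ⁆ v
    offQ v off with covers v
    ... | zero , onQ = ⊥-elim (off onQ)
    zf : IsZeroForcingSet G ⁅ start Q ⁆
    zf = forcing-from-path G ⁅ start Q ⁆ Q (x∈⁅x⁆ _) offQ
  atLeastTwo (suc (suc l)) _ _ = s≤s (s≤s z≤n)

zeroForcingNumber-exact : ∀ {N} (G : Graph N) k (g : Fin k → Fin N) →
  IsZeroForcingSet G (image k g) → (∀ S → IsZeroForcingSet G S → k ≤ ∣ S ∣) → ZeroForcingNumber G k
zeroForcingNumber-exact G k g zf lower = (image k g , ≤-antisym (∣image∣≤ k g) (lower _ zf) , zf) , lower

Realisation : ℕ → ℕ → ℕ → Set₁
Realisation m n k =
  Σ ℕ λ N → Σ (Graph N) λ G →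
    PathCoverNumber G 2 ×
    (∃[ P₁ ] ∃[ P₂ ] (len P₁ ≡ m × len P₂ ≡ n × IsPathCover G (P₁ ∷ P₂ ∷ []))) ×
    ZeroForcingNumber G k

-- The realising graphs: vertices 0 … m-1 form a path u, vertices m … m+n-1 a path w,
-- and further edges join left vertices a < m to right vertices b ≥ m with Cross a b.
module TwoPaths (m n : ℕ) (h₁ : 1 ≤ m) (h₂ : 1 ≤ n) (Cross : ℕ → ℕ → Set)
                (cross-sides : ∀ {a b} → Cross a b → a < m × m ≤ b)
                (cross? : ∀ a b → Dec (Cross a b)) where

  Consecutive : ℕ → ℕ → Set
  Consecutive a b = (a ≡ suc b) ⊎ (b ≡ suc a)

  SameSide : ℕ → ℕ → Set
  SameSide a b = (a < m × b < m) ⊎ (m ≤ a × m ≤ b)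

  Edge : ℕ → ℕ → Set
  Edge a b = (Consecutive a b × SameSide a b) ⊎ (Cross a b ⊎ Cross b a)

  edge-sym : ∀ {a b} → Edge a b → Edge b a
  edge-sym (inj₁ (ab , inj₁ (a< , b<)))  = inj₁ (swap ab , inj₁ (b< , a<))
  edge-sym (inj₁ (ab , inj₂ (m≤a , m≤b))) = inj₁ (swap ab , inj₂ (m≤b , m≤a))
  edge-sym (inj₂ cross)                   = inj₂ (swap cross)

  edge-irrefl : ∀ {a} → ¬ Edge a a
  edge-irrefl (inj₁ (inj₁ a≡1+a , _)) = <⇒≢ (n<1+n _) a≡1+a
  edge-irrefl (inj₁ (inj₂ a≡1+a , _)) = <⇒≢ (n<1+n _) a≡1+a
  edge-irrefl (inj₂ (inj₁ cross))     = <⇒≱ (proj₁ (cross-sides cross)) (proj₂ (cross-sides cross))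
  edge-irrefl (inj₂ (inj₂ cross))     = <⇒≱ (proj₁ (cross-sides cross)) (proj₂ (cross-sides cross))

  edge? : ∀ a b → Dec (Edge a b)
  edge? a b = (((a ℕ.≟ suc b) ⊎-dec (b ℕ.≟ suc a)) ×-dec
               (((a <? m) ×-dec (b <? m)) ⊎-dec ((m ≤? a) ×-dec (m ≤? b))))
              ⊎-dec (cross? a b ⊎-dec cross? b a)

  edge-left : ∀ {a b} → a < m → b < m → Edge a b → Consecutive a b
  edge-left a< b< (inj₁ (ab , _))     = ab
  edge-left a< b< (inj₂ (inj₁ cross)) = ⊥-elim (<⇒≱ b< (proj₂ (cross-sides cross)))
  edge-left a< b< (inj₂ (inj₂ cross)) = ⊥-elim (<⇒≱ a< (proj₂ (cross-sides cross)))

  edge-right : ∀ {a b} → m ≤ a → m ≤ b → Edge a b → Consecutive a b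
  edge-right m≤a m≤b (inj₁ (ab , _))     = ab
  edge-right m≤a m≤b (inj₂ (inj₁ cross)) = ⊥-elim (<⇒≱ (proj₁ (cross-sides cross)) m≤a)
  edge-right m≤a m≤b (inj₂ (inj₂ cross)) = ⊥-elim (<⇒≱ (proj₁ (cross-sides cross)) m≤b)

  edge-across : ∀ {a b} → a < m → m ≤ b → Edge a b → Cross a b
  edge-across a< m≤b (inj₁ (_ , inj₁ (_ , b<)))   = ⊥-elim (<⇒≱ b< m≤b)
  edge-across a< m≤b (inj₁ (_ , inj₂ (m≤a , _))) = ⊥-elim (<⇒≱ a< m≤a)
  edge-across a< m≤b (inj₂ (inj₁ cross))          = cross
  edge-across a< m≤b (inj₂ (inj₂ cross))          = ⊥-elim (<⇒≱ a< (proj₂ (cross-sides cross)))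

  N : ℕ
  N = m + n

  G : Graph N
  G = record { Adj = λ x y → Edge (toℕ x) (toℕ y) ; sym = edge-sym ; irrefl = edge-irrefl }

  u : Fin m → Fin N
  u i = i Fin.↑ˡ n

  w : Fin n → Fin N
  w j = m Fin.↑ʳ j

  u-left : ∀ i → toℕ (u i) < m
  u-left i = subst (_< m) (sym (Finₚ.toℕ-↑ˡ i n)) (Finₚ.toℕ<n i)

  w-right : ∀ j → m ≤ toℕ (w j)
  w-right j = subst (m ≤_) (sym (Finₚ.toℕ-↑ʳ m j)) (m≤m+n m (toℕ j))

  u≢w : ∀ i j → u i ≢ w j
  u≢w i j e = <⇒≱ (u-left i) (subst (λ x → m ≤ toℕ x) (sym e) (w-right j))

  consecutive-shift : ∀ {a b} → Consecutive (m + a) (m + b) → Consecutive a b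
  consecutive-shift (inj₁ e) = inj₁ (+-cancelˡ-≡ m _ _ (trans e (sym (+-suc m _))))
  consecutive-shift (inj₂ e) = inj₂ (+-cancelˡ-≡ m _ _ (trans e (sym (+-suc m _))))

  consecutive-unshift : ∀ {a b} → Consecutive a b → Consecutive (m + a) (m + b)
  consecutive-unshift (inj₁ e) = inj₁ (trans (cong (m +_) e) (+-suc m _))
  consecutive-unshift (inj₂ e) = inj₂ (trans (cong (m +_) e) (+-suc m _))

  P₁ : InducedPath G
  P₁ = record
    { len = m ; nonempty = h₁ ; vert = u ; inj = Finₚ.↑ˡ-injective n _ _
    ; adj⇒cons = λ i j a → subst₂ Consecutive (Finₚ.toℕ-↑ˡ i n) (Finₚ.toℕ-↑ˡ j n)
                             (edge-left (u-left i) (u-left j) a)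
    ; cons⇒adj = λ i j ij → subst₂ Edge (sym (Finₚ.toℕ-↑ˡ i n)) (sym (Finₚ.toℕ-↑ˡ j n))
                             (inj₁ (ij , inj₁ (Finₚ.toℕ<n i , Finₚ.toℕ<n j)))
    }

  P₂ : InducedPath G
  P₂ = record
    { len = n ; nonempty = h₂ ; vert = w ; inj = Finₚ.↑ʳ-injective m _ _
    ; adj⇒cons = λ i j a → consecutive-shift (subst₂ Consecutive (Finₚ.toℕ-↑ʳ m i) (Finₚ.toℕ-↑ʳ m j)
                             (edge-right (w-right i) (w-right j) a))
    ; cons⇒adj = λ i j ij → subst₂ Edge (sym (Finₚ.toℕ-↑ʳ m i)) (sym (Finₚ.toℕ-↑ʳ m j))
                             (inj₁ (consecutive-unshift ij , inj₂ (m≤m+n m _ , m≤m+n m _)))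
    }

  side : ∀ x → OnPath P₁ x ⊎ OnPath P₂ x
  side x with Fin.splitAt m x in eq
  ... | inj₁ i = inj₁ (i , Finₚ.splitAt⁻¹-↑ˡ eq)
  ... | inj₂ j = inj₂ (j , Finₚ.splitAt⁻¹-↑ʳ eq)

  cover : IsPathCover G (P₁ ∷ P₂ ∷ [])
  cover = covers , disjoint
    where
    covers : ∀ v → ∃[ i ] ∃[ p ] vert (lookup (P₁ ∷ P₂ ∷ []) i) p ≡ v
    covers v with side v
    ... | inj₁ onP₁ = zero , onP₁
    ... | inj₂ onP₂ = suc zero , onP₂
    disjoint : ∀ (i j : Fin 2) p q →
      vert (lookup (P₁ ∷ P₂ ∷ []) i) p ≡ vert (lookup (P₁ ∷ P₂ ∷ []) j) q → i ≡ j
    disjoint zero       zero       p q e = refl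
    disjoint zero       (suc zero) p q e = ⊥-elim (u≢w p q e)
    disjoint (suc zero) zero       p q e = ⊥-elim (u≢w q p (sym e))
    disjoint (suc zero) (suc zero) p q e = refl

  realisation : ∀ k (g : Fin k → Fin N) → 2 ≤ k → IsZeroForcingSet G (image k g) →
                (∀ S → IsZeroForcingSet G S → k ≤ ∣ S ∣) → Realisation m n k
  realisation k g 2≤k zf lower =
    N , G , pathCoverNumber-two G P₁ P₂ cover (λ S zf′ → ≤-trans 2≤k (lower S zf′)) ,
    (P₁ , P₂ , refl , refl , cover) , zeroForcingNumber-exact G k g zf lower

-- k = 2: two disjoint paths.  Each path is a component, so a zero forcing set meets
-- both of them; conversely the two first vertices force everything.
module PathPair (m n : ℕ) (h₁ : 1 ≤ m) (h₂ : 1 ≤ n) where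
  open TwoPaths m n h₁ h₂ (λ _ _ → ⊥) (λ ()) (λ _ _ → no λ ())

  left-closed : ∀ {x y} → Adj G x y → toℕ y < m → toℕ x < m
  left-closed (inj₁ (_ , inj₁ (x< , _)))   _  = x<
  left-closed (inj₁ (_ , inj₂ (_ , m≤y))) y< = ⊥-elim (<⇒≱ y< m≤y)
  left-closed (inj₂ (inj₁ ()))
  left-closed (inj₂ (inj₂ ()))

  right-closed : ∀ {x y} → Adj G x y → m ≤ toℕ y → m ≤ toℕ x
  right-closed (inj₁ (_ , inj₂ (m≤x , _)))  _   = m≤x
  right-closed (inj₁ (_ , inj₁ (_ , y<))) m≤y = ⊥-elim (<⇒≱ y< m≤y)
  right-closed (inj₂ (inj₁ ()))
  right-closed (inj₂ (inj₂ ()))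

  lower : ∀ S → IsZeroForcingSet G S → 2 ≤ ∣ S ∣
  lower S zf
    with forced⇒meets G S (λ x → toℕ x < m) left-closed (zf (start P₁)) (u-left _)
       | forced⇒meets G S (λ x → m ≤ toℕ x) right-closed (zf (start P₂)) (w-right _)
  ... | s , s∈S , s< | t , t∈S , m≤t =
    distinct⇒≤∣∣ 2 S (distinct-pair (λ s≡t → <⇒≱ s< (subst (λ x → m ≤ toℕ x) (sym s≡t) m≤t)) s∈S t∈S)

  starts : Fin 2 → Fin N
  starts zero       = start P₁
  starts (suc zero) = start P₂

  forced-P₂ : ∀ j → Black G (image 2 starts) (w j)
  forced-P₂ = forcePath G _ P₂ (initial (∈image 2 starts (suc zero))) offP₂
    where
    offP₂ : ∀ j x → Adj G (w j) x → ¬ OnPath P₂ x → Black G (image 2 starts) x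
    offP₂ j x a off with side x
    ... | inj₁ (i , refl) = ⊥-elim (edge-across (u-left i) (w-right j) (Graph.sym G a))
    ... | inj₂ onP₂       = ⊥-elim (off onP₂)

  forces : IsZeroForcingSet G (image 2 starts)
  forces = forcing-from-path G _ P₁ (∈image 2 starts zero) offP₁
    where
    offP₁ : ∀ x → ¬ OnPath P₁ x → Black G (image 2 starts) x
    offP₁ x off with side x
    ... | inj₁ onP₁       = ⊥-elim (off onP₁)
    ... | inj₂ (j , refl) = forced-P₂ j

  realises-2 : Realisation m n 2
  realises-2 = realisation 2 starts ≤-refl forces lower

-- k = c + 1 with 2 ≤ c ≤ min(m, n): join each of the first c vertices of u to each of the
-- first c vertices of w.  These 2c vertices form the core.
module Biclique (m n d : ℕ) (1≤d : 1 ≤ d) (c≤m : suc d ≤ m) (c≤n : suc d ≤ n) where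
  c : ℕ
  c = suc d

  Cross : ℕ → ℕ → Set
  Cross a b = a < c × m ≤ b × b < m + c

  open TwoPaths m n (≤-trans (s≤s z≤n) c≤m) (≤-trans (s≤s z≤n) c≤n) Cross
                (λ (a< , m≤b , _) → <-≤-trans a< c≤m , m≤b)
                (λ a b → (a <? c) ×-dec ((m ≤? b) ×-dec (b <? m + c)))

  -- Upper bound: the first c vertices of u and the first vertex of w force G.  The path
  -- w is forced along itself (its other neighbours are core vertices of u), then u.
  generators : Fin (suc c) → Fin N
  generators zero    = start P₂
  generators (suc i) = u (Fin.inject≤ i c≤m)

  S₀ : Subset N
  S₀ = image (suc c) generators

  coreLeft∈S₀ : ∀ i → toℕ i < c → u i ∈ S₀
  coreLeft∈S₀ i i<c = subst (_∈ S₀) (cong u (toℕ-injective (trans (Finₚ.toℕ-inject≤ _ c≤m) (Finₚ.toℕ-fromℕ< i<c))))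
                        (∈image _ generators (suc (fromℕ< i<c)))

  forced-P₂ : ∀ j → Black G S₀ (w j)
  forced-P₂ = forcePath G S₀ P₂ (initial (∈image _ generators zero)) offP₂
    where
    offP₂ : ∀ j x → Adj G (w j) x → ¬ OnPath P₂ x → Black G S₀ x
    offP₂ j x a off with side x
    ... | inj₁ (i , refl) = initial (coreLeft∈S₀ i (subst (_< c) (Finₚ.toℕ-↑ˡ i n)
                              (proj₁ (edge-across (u-left i) (w-right j) (Graph.sym G a)))))
    ... | inj₂ onP₂       = ⊥-elim (off onP₂)

  forces : IsZeroForcingSet G S₀
  forces = forcing-from-path G S₀ P₁ (coreLeft∈S₀ _ (subst (_< c) (sym (Finₚ.toℕ-fromℕ< _)) (s≤s z≤n))) offP₁
    where
    offP₁ : ∀ x → ¬ OnPath P₁ x → Black G S₀ x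
    offP₁ x off with side x
    ... | inj₁ onP₁       = ⊥-elim (off onP₁)
    ... | inj₂ (j , refl) = forced-P₂ j

  Core : ℕ → Set
  Core a = a < c ⊎ (m ≤ a × a < m + c)

  core? : ∀ a → Dec (Core a)
  core? a = (a <? c) ⊎-dec ((m ≤? a) ×-dec (a <? m + c))

  generators-core : Distinct (suc c) (λ x → Core (toℕ x))
  generators-core = generators , injective , core
    where
    injective : Injective _≡_ _≡_ generators
    injective {zero}  {zero}  _ = refl
    injective {zero}  {suc j} e = ⊥-elim (u≢w _ _ (sym e))
    injective {suc i} {zero}  e = ⊥-elim (u≢w _ _ e)
    injective {suc i} {suc j} e = cong suc (Finₚ.inject≤-injective c≤m c≤m i j (Finₚ.↑ˡ-injective n _ _ e))
    core : ∀ i → Core (toℕ (generators i))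
    core zero    = inj₂ (w-right _ , subst (_< m + c) (sym (Finₚ.toℕ-↑ʳ m _))
                     (+-monoʳ-< m (subst (_< c) (sym (Finₚ.toℕ-fromℕ< _)) (s≤s z≤n))))
    core (suc i) = inj₁ (subst (_< c) (sym (trans (Finₚ.toℕ-↑ˡ _ n) (Finₚ.toℕ-inject≤ i c≤m))) (Finₚ.toℕ<n i))

  CoreEdge : ℕ → ℕ → Set
  CoreEdge a b = Edge a b × Core a × Core b

  G′ : Graph N
  G′ = record { Adj    = λ x y → CoreEdge (toℕ x) (toℕ y)
              ; sym    = λ (e , core-a , core-b) → edge-sym e , core-b , core-a
              ; irrefl = λ e → edge-irrefl (proj₁ e) }

  adj′? : ∀ x y → Dec (Adj G′ x y)
  adj′? x y = edge? _ _ ×-dec (core? _ ×-dec core? _)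

  retract : ℕ → ℕ
  retract a with a <? m
  ... | yes _ = a ⊓ d
  ... | no  _ = m + ((a ∸ m) ⊓ d)

  retract-left : ∀ {a} → a < m → retract a ≡ a ⊓ d
  retract-left {a} a< with a <? m
  ... | yes _ = refl
  ... | no  ≮ = ⊥-elim (≮ a<)

  retract-right : ∀ {a} → m ≤ a → retract a ≡ m + ((a ∸ m) ⊓ d)
  retract-right {a} m≤a with a <? m
  ... | yes a< = ⊥-elim (<⇒≱ a< m≤a)
  ... | no  _  = refl

  ∸m<c : ∀ {a} → m ≤ a → a < m + c → a ∸ m < c
  ∸m<c {a} m≤a a< = subst (a ∸ m <_) (m+n∸m≡n m c) (∸-monoˡ-< a< m≤a)

  retract-core : ∀ {a} → Core a → retract a ≡ a
  retract-core (inj₁ a<c)       = trans (retract-left (<-≤-trans a<c c≤m)) (m≤n⇒m⊓n≡m (≤-pred a<c))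
  retract-core (inj₂ (m≤a , a<)) =
    trans (retract-right m≤a) (trans (cong (m +_) (m≤n⇒m⊓n≡m (≤-pred (∸m<c m≤a a<)))) (m+[n∸m]≡n m≤a))

  retract-< : ∀ {a} → a < N → retract a < N
  retract-< {a} a<N with a <? m
  ... | yes _ = ≤-<-trans (m⊓n≤m a d) a<N
  ... | no  ≮ = ≤-<-trans (≤-trans (+-monoʳ-≤ m (m⊓n≤m (a ∸ m) d)) (≤-reflexive (m+[n∸m]≡n (≮⇒≥ ≮)))) a<N

  nearby : ∀ {a b} → Consecutive a b → d < a → d ≤ b
  nearby (inj₁ refl) d<a = ≤-pred d<a
  nearby (inj₂ refl) d<a = ≤-trans (<⇒≤ d<a) (n≤1+n _)

  collapse : ∀ {a b} → Consecutive a b → ¬ (a ≤ d × b ≤ d) → a ⊓ d ≡ b ⊓ d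
  collapse {a} {b} ab notBoth with a ≤? d | b ≤? d
  ... | yes a≤ | yes b≤ = ⊥-elim (notBoth (a≤ , b≤))
  ... | no  a≰ | _      = trans (m≥n⇒m⊓n≡n (<⇒≤ (≰⇒> a≰))) (sym (m≥n⇒m⊓n≡n (nearby ab (≰⇒> a≰))))
  ... | yes _  | no b≰  = trans (m≥n⇒m⊓n≡n (nearby (swap ab) (≰⇒> b≰))) (sym (m≥n⇒m⊓n≡n (<⇒≤ (≰⇒> b≰))))

  consecutive-∸ : ∀ {a b} → m ≤ a → m ≤ b → Consecutive a b → Consecutive (a ∸ m) (b ∸ m)
  consecutive-∸ m≤a m≤b (inj₁ refl) = inj₁ (+-∸-assoc 1 m≤b)
  consecutive-∸ m≤a m≤b (inj₂ refl) = inj₂ (+-∸-assoc 1 m≤a)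

  edge-retract : ∀ {a b} → Edge a b → retract a ≢ retract b → Core a × Core b
  edge-retract (inj₂ (inj₁ (a<c , m≤b , b<))) _ = inj₁ a<c , inj₂ (m≤b , b<)
  edge-retract (inj₂ (inj₂ (b<c , m≤a , a<))) _ = inj₂ (m≤a , a<) , inj₁ b<c
  edge-retract {a} {b} (inj₁ (ab , inj₁ (a<m , b<m))) apart with (a ≤? d) ×-dec (b ≤? d)
  ... | yes (a≤ , b≤) = inj₁ (s≤s a≤) , inj₁ (s≤s b≤)
  ... | no  notBoth   = ⊥-elim (apart (begin
    retract a  ≡⟨ retract-left a<m ⟩
    a ⊓ d      ≡⟨ collapse ab notBoth ⟩
    b ⊓ d      ≡⟨ sym (retract-left b<m) ⟩
    retract b  ∎))
    where open ≡-Reasoning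
  edge-retract {a} {b} (inj₁ (ab , inj₂ (m≤a , m≤b))) apart with ((a ∸ m) ≤? d) ×-dec ((b ∸ m) ≤? d)
  ... | yes (a≤ , b≤) = inj₂ (m≤a , inCore m≤a a≤) , inj₂ (m≤b , inCore m≤b b≤)
    where
    inCore : ∀ {x} → m ≤ x → x ∸ m ≤ d → x < m + c
    inCore {x} m≤x x≤ = subst (_< m + c) (m+[n∸m]≡n m≤x) (+-monoʳ-< m (s≤s x≤))
  ... | no  notBoth   = ⊥-elim (apart (begin
    retract a              ≡⟨ retract-right m≤a ⟩
    m + ((a ∸ m) ⊓ d)      ≡⟨ cong (m +_) (collapse (consecutive-∸ m≤a m≤b ab) notBoth) ⟩
    m + ((b ∸ m) ⊓ d)      ≡⟨ sym (retract-right m≤b) ⟩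
    retract b              ∎))
    where open ≡-Reasoning

  φ : Fin N → Fin N
  φ x = fromℕ< (retract-< (Finₚ.toℕ<n x))

  φ-fixes : ∀ {x} → Core (toℕ x) → φ x ≡ x
  φ-fixes core-x = toℕ-injective (trans (Finₚ.toℕ-fromℕ< _) (retract-core core-x))

  kept : ∀ {x y} → Adj G x y → φ x ≢ φ y → φ x ≡ x × φ y ≡ y × Adj G′ x y
  kept {x} {y} a φx≢φy with edge-retract a (λ e → φx≢φy (toℕ-injective
                             (trans (Finₚ.toℕ-fromℕ< _) (trans e (sym (Finₚ.toℕ-fromℕ< _))))))
  ... | core-x , core-y = φ-fixes core-x , φ-fixes core-y , a , core-x , core-y

  back : ∀ {x y} → Adj G′ x y → Adj G x y × φ y ≡ y
  back (a , _ , core-y) = a , φ-fixes core-y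

  -- Closed neighbourhoods in G′.  A core vertex has a path neighbour in the core (each
  -- path has c ≥ 2 core vertices) and is joined to the c core vertices of the other side.
  nbrIndex : ℕ → ℕ
  nbrIndex zero    = 1
  nbrIndex (suc a) = a

  nbrIndex-consecutive : ∀ a → Consecutive a (nbrIndex a)
  nbrIndex-consecutive zero    = inj₂ refl
  nbrIndex-consecutive (suc a) = inj₁ refl

  nbrIndex-< : ∀ {a} → a < c → nbrIndex a < c
  nbrIndex-< {zero}  _   = s≤s 1≤d
  nbrIndex-< {suc a} a<c = <-trans (n<1+n a) a<c

  pathNbr : ∀ {a} → Core a → Σ ℕ λ b → b < N × CoreEdge a b × SameSide a b
  pathNbr {a} (inj₁ a<c) =
    nbrIndex a , <-≤-trans b<c (≤-trans c≤m (m≤m+n m n)) ,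
    (inj₁ (nbrIndex-consecutive a , same) , inj₁ a<c , inj₁ b<c) , same
    where
    b<c : nbrIndex a < c
    b<c = nbrIndex-< a<c
    same : SameSide a (nbrIndex a)
    same = inj₁ (<-≤-trans a<c c≤m , <-≤-trans b<c c≤m)
  pathNbr {a} (inj₂ (m≤a , a<)) =
    m + nbrIndex (a ∸ m) , +-monoʳ-< m (<-≤-trans b<c c≤n) ,
    (inj₁ (ab , same) , inj₂ (m≤a , a<) , inj₂ (m≤m+n m _ , +-monoʳ-< m b<c)) , same
    where
    b<c : nbrIndex (a ∸ m) < c
    b<c = nbrIndex-< (∸m<c m≤a a<)
    ab : Consecutive a (m + nbrIndex (a ∸ m))
    ab = subst (λ t → Consecutive t (m + nbrIndex (a ∸ m))) (m+[n∸m]≡n m≤a) (consecutive-unshift (nbrIndex-consecutive (a ∸ m)))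
    same : SameSide a (m + nbrIndex (a ∸ m))
    same = inj₂ (m≤a , m≤m+n m _)

  numbered : ∀ {P : ℕ → Set} (b : ℕ → ℕ) → (∀ {i j} → b i ≡ b j → i ≡ j) →
             (∀ j → j < c → b j < N × P (b j)) → Distinct c (λ y → P (toℕ y))
  numbered {P} b b-inj ok = vertex , vertex-inj ,
                            λ j → subst P (sym (Finₚ.toℕ-fromℕ< _)) (proj₂ (ok (toℕ j) (Finₚ.toℕ<n j)))
    where
    vertex : Fin c → Fin N
    vertex j = fromℕ< (proj₁ (ok (toℕ j) (Finₚ.toℕ<n j)))
    vertex-inj : Injective _≡_ _≡_ vertex
    vertex-inj e = toℕ-injective (b-inj (trans (sym (Finₚ.toℕ-fromℕ< _)) (trans (cong toℕ e) (Finₚ.toℕ-fromℕ< _))))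

  otherSide : ∀ {a} → Core a → Distinct c (λ y → CoreEdge a (toℕ y) × ¬ SameSide a (toℕ y))
  otherSide {a} (inj₁ a<c) = numbered {P = λ b → CoreEdge a b × ¬ SameSide a b} (m +_) (λ e → +-cancelˡ-≡ m _ _ e) λ j j<c →
    +-monoʳ-< m (<-≤-trans j<c c≤n) ,
    (inj₂ (inj₁ (a<c , m≤m+n m j , +-monoʳ-< m j<c)) , inj₁ a<c , inj₂ (m≤m+n m j , +-monoʳ-< m j<c)) ,
    λ { (inj₁ (_ , m+j<m)) → <⇒≱ m+j<m (m≤m+n m j) ; (inj₂ (m≤a , _)) → <⇒≱ (<-≤-trans a<c c≤m) m≤a }
  otherSide {a} (inj₂ (m≤a , a<)) = numbered {P = λ b → CoreEdge a b × ¬ SameSide a b} (λ j → j) (λ e → e) λ j j<c →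
    <-≤-trans j<c (≤-trans c≤m (m≤m+n m n)) ,
    (inj₂ (inj₂ (j<c , m≤a , a<)) , inj₂ (m≤a , a<) , inj₁ j<c) ,
    λ { (inj₁ (a<m , _)) → <⇒≱ a<m m≤a ; (inj₂ (_ , m≤j)) → <⇒≱ (<-≤-trans j<c c≤m) m≤j }

  coreNbhd : ∀ {x y} → Adj G′ x y → Distinct (suc (suc c)) (ClosedNbhd G′ x)
  coreNbhd {x} (_ , core-x , _) with pathNbr core-x
  ... | b , b<N , xb , same =
    distinct-cons {P = ClosedNbhd G′ x} {Q = Adj G′ x} (inj₁ refl)
      (distinct-cons {P = Adj G′ x} {Q = λ y → Adj G′ x y × ¬ SameSide (toℕ x) (toℕ y)} xp (otherSide core-x)
                     (λ (xy , other) → (λ { refl → other samep }) , xy))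
      (λ {y} xy → (λ { refl → irrefl G′ xy }) , inj₂ xy)
    where
    toℕ-p : toℕ (fromℕ< b<N) ≡ b
    toℕ-p = Finₚ.toℕ-fromℕ< b<N
    xp : Adj G′ x (fromℕ< b<N)
    xp = subst (CoreEdge (toℕ x)) (sym toℕ-p) xb
    samep : SameSide (toℕ x) (toℕ (fromℕ< b<N))
    samep = subst (SameSide (toℕ x)) (sym toℕ-p) same

  -- Lower bound.  φ[S] forces G′ by `transfer`.  If φ[S] misses a core vertex, the degree
  -- bound in G′ gives c + 1 members of φ[S]; otherwise φ[S] contains c + 1 generators.
  lower : ∀ S → IsZeroForcingSet G S → suc c ≤ ∣ S ∣
  lower S zf = distinct⇒≤∣∣ (suc c) S (distinct-preimage S φ (distinct-map (λ {y} → ∈toSubset⁻ φ[S]? {y}) inφ[S]))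
    where
    φ[S]? : ∀ y → Dec (∃[ s ] (s ∈ S × φ s ≡ y))
    φ[S]? y = any? λ s → (s ∈? S) ×-dec (φ s Fin.≟ y)
    S′ : Subset N
    S′ = toSubset φ[S]?
    forced′ : ∀ x → Black G′ S′ (φ x)
    forced′ x = transfer G G′ φ S S′ (λ {v} v∈S → ∈toSubset⁺ φ[S]? (v , v∈S , refl)) kept back (zf x)
    inφ[S] : Distinct (suc c) (_∈ S′)
    inφ[S] with any? (λ x → core? (toℕ x) ×-dec ¬? (x ∈? S′))
    ... | yes (x , core-x , x∉S′) =
      firstForce-bound G′ adj′? S′ coreNbhd (subst (Black G′ S′) (φ-fixes core-x) (forced′ x)) x∉S′
    ... | no  coreInS′ = distinct-map {P = λ x → Core (toℕ x)} (λ {x} core-x → decidable-stable (x ∈? S′) λ x∉S′ → coreInS′ (x , core-x , x∉S′))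
                                      generators-core

  realises-c+1 : Realisation m n (suc c)
  realises-c+1 = realisation (suc c) generators (s≤s (s≤s z≤n)) forces lower

realisations : (m n k : ℕ) → 1 ≤ m → 1 ≤ n → 2 ≤ k → k ≤ (m ⊓ n) + 1 → Realisation m n k
realisations m n zero                h₁ h₂ () _
realisations m n (suc zero)          h₁ h₂ (s≤s ()) _
realisations m n (suc (suc zero))    h₁ h₂ _ _  = PathPair.realises-2 m n h₁ h₂
realisations m n (suc (suc (suc d))) h₁ h₂ _ k≤ =
  Biclique.realises-c+1 m n (suc d) (s≤s z≤n) (≤-trans c≤min (m⊓n≤m m n)) (≤-trans c≤min (m⊓n≤n m n))
  where
  c≤min : suc (suc d) ≤ m ⊓ n
  c≤min = ≤-pred (subst (suc (suc (suc d)) ≤_) (+-comm (m ⊓ n) 1) k≤)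

proposition3p5 :
    ((N : ℕ) (G : Graph N) (P₁ P₂ : InducedPath G) →
      PathCoverNumber G 2 → IsPathCover G (P₁ ∷ P₂ ∷ []) →
      ∀ (z : ℕ) → ZeroForcingNumber G z →
      2 ≤ z × z ≤ (len P₁ ⊓ len P₂) + 1)
    ×
    ((m n k : ℕ) → 1 ≤ m → 1 ≤ n → 2 ≤ k → k ≤ (m ⊓ n) + 1 →
      Σ ℕ λ N → Σ (Graph N) λ G →
        PathCoverNumber G 2 ×
        (∃[ P₁ ] ∃[ P₂ ] (len P₁ ≡ m × len P₂ ≡ n × IsPathCover G (P₁ ∷ P₂ ∷ []))) ×
        ZeroForcingNumber G k)
proposition3p5 = zeroForcing-bounds , realisations
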